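{- Consider the following algorithm. Input: a subcube partition $F=\{s_1,\dots,s_m\}$ of $\{0,1\}^n$ (subcubes given as words in $\{0,1,*\}^n$). For each pair $1\le i<j\le m$: set $G\gets\{s_i,s_j\}$; while some $s_k\notin G$ intersects $\bigvee G$, set $G\gets G\cup\{s_k\}$; when the loop ends, if $G\ne F$, return "Reducible: $\bigcup G$ is a subcube". If no pair triggers a return, return "Irreducible". Then this algorithm runs in time polynomial in $n$ and $m$, and its output is correct: it outputs "Reducible" (together with a set $G\subseteq F$, $1<|G|<|F|$, whose union is a subcube) if and only if $F$ is reducible, and outputs "Irreducible" otherwise.
   Context: A subcube of $\{0,1\}^n$ is a set of the form $\{x\in\{0,1\}^n: x_{i_1}=b_1,\dots,x_{i_d}=b_d\}$, identified with a word $s\in\{0,1,*\}^n$ where $s_i=*$ means coordinate $i$ is unconstrained. A subcube partition of length $n$ is a partition of $\{0,1\}^n$ into subcubes. It is reducible if there is $G\subset F$ with $1<|G|<|F|$ whose union is a subcube, and irreducible otherwise. The join $s\vee t$ of subcubes $s,t$ is the smallest subcube containing both: $(s\vee t)_i=b$ if $s_i=t_i=b\in\{0,1\}$ and $*$ otherwise; $\bigvee G$ is the join of all subcubes in $G$. Two subcubes intersect iff there is no coordinate $i$ with $s_i,t_i\ne *$ and $s_i\ne t_i$. -}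

module Defs where

open import Data.Bool using (Bool; true; false; _∧_; not; if_then_else_)
open import Data.Maybe using (Maybe; just; nothing)
open import Data.Nat using (ℕ; zero; suc; _+_; _<_)
open import Data.Fin using (Fin; toℕ)
open import Data.Vec using (Vec; []; _∷_; lookup; zipWith)
open import Data.List using (List; []; _∷_; map; concatMap; filter; allFin)
open import Data.Fin.Subset using (Subset; _∈_; ∣_∣; ⁅_⁆; _∪_)
open import Data.Product using (Σ; ∃; _×_; _,_; proj₁; proj₂)
open import Data.Unit using (⊤)
open import Relation.Nullary using (¬_)
open import Relation.Binary.PropositionalEquality using (_≡_)
open import Data.Vec.Relation.Binary.Pointwise.Inductive using (Pointwise)
import Data.Nat as ℕ

-- Subcubes of {0,1}^n as words in {0,1,*}^n  (nothing = *)

Cell : Set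
Cell = Maybe Bool

Subcube : ℕ → Set
Subcube n = Vec Cell n

Point : ℕ → Set
Point n = Vec Bool n

Match : Bool → Cell → Set
Match x nothing  = ⊤
Match x (just b) = x ≡ b

_∈ᶜ_ : ∀ {n} → Point n → Subcube n → Set
x ∈ᶜ s = Pointwise Match x s

IsPartition : ∀ {n m} → Vec (Subcube n) m → Set
IsPartition {n} {m} F =
  (∀ (x : Point n) → ∃ λ (i : Fin m) → x ∈ᶜ lookup F i)
  × (∀ (x : Point n) (i j : Fin m) → x ∈ᶜ lookup F i → x ∈ᶜ lookup F j → i ≡ j)

UnionIsSubcube : ∀ {n m} → Vec (Subcube n) m → Subset m → Set
UnionIsSubcube {n} {m} F G =
  Σ (Subcube n) λ t → ∀ (x : Point n) →
    (x ∈ᶜ t → ∃ λ (i : Fin m) → i ∈ G × x ∈ᶜ lookup F i)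
    × ((∃ λ (i : Fin m) → i ∈ G × x ∈ᶜ lookup F i) → x ∈ᶜ t)

ReducingSet : ∀ {n m} → Vec (Subcube n) m → Subset m → Set
ReducingSet {n} {m} F G = 1 < ∣ G ∣ × ∣ G ∣ < m × UnionIsSubcube F G

Reducible : ∀ {n m} → Vec (Subcube n) m → Set
Reducible {n} {m} F = Σ (Subset m) λ G → ReducingSet F G

Irreducible : ∀ {n m} → Vec (Subcube n) m → Set
Irreducible F = ¬ Reducible F

-- Cost model: each letter-wise operation on a subcube word (join, intersection
-- test) costs n; each elementary bookkeeping step (visiting an index, testing
-- G = F) costs 1.

eqB : Bool → Bool → Bool
eqB true  true  = true
eqB false false = true
eqB _     _     = false

joinCell : Cell → Cell → Cell
joinCell (just a) (just b) = if eqB a b then just a else nothing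
joinCell _        _        = nothing

meetCell : Cell → Cell → Bool
meetCell (just a) (just b) = eqB a b
meetCell _        _        = true

allTrue : ∀ {k} → Vec Bool k → Bool
allTrue []       = true
allTrue (b ∷ bs) = b ∧ allTrue bs

joinC : ∀ {n} → Subcube n → Subcube n → Subcube n × ℕ
joinC {n} s t = zipWith joinCell s t , n

intersectsC : ∀ {n} → Subcube n → Subcube n → Bool × ℕ
intersectsC {n} s t = allTrue (zipWith meetCell s t) , n

-- join with an optional accumulator (nothing = join of the empty family)
joinMaybe : ∀ {n} → Maybe (Subcube n) → Subcube n → Maybe (Subcube n) × ℕ
joinMaybe nothing  t = just t , 1
joinMaybe (just s) t = just (proj₁ (joinC s t)) , proj₂ (joinC s t)

module Algorithm {n m : ℕ} (F : Vec (Subcube n) m) where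

  bigJoinOver : Subset m → Maybe (Subcube n) → List (Fin m) → Maybe (Subcube n) × ℕ
  bigJoinOver G acc []       = acc , 0
  bigJoinOver G acc (k ∷ ks) with lookup G k
  ... | false = let r = bigJoinOver G acc ks in proj₁ r , suc (proj₂ r)
  ... | true  = let a = joinMaybe acc (lookup F k)
                    r = bigJoinOver G (proj₁ a) ks
                in proj₁ r , suc (proj₂ a + proj₂ r)

  bigJoin : Subset m → Maybe (Subcube n) × ℕ
  bigJoin G = bigJoinOver G nothing (allFin m)

  findNext : Subset m → Maybe (Subcube n) → List (Fin m) → Maybe (Fin m) × ℕ
  findNext G J        []       = nothing , 0
  findNext G nothing  (k ∷ ks) = nothing , 1
  findNext G (just J) (k ∷ ks) with lookup G k
  ... | true  = let r = findNext G (just J) ks in proj₁ r , suc (proj₂ r)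
  ... | false with intersectsC (lookup F k) J
  ...   | true  , c = just k , suc c
  ...   | false , c = let r = findNext G (just J) ks in proj₁ r , suc (c + proj₂ r)

  -- the while loop: G ← G ∪ {s_k} while some s_k ∉ G intersects ⋁ G.
  -- Each iteration adds a new element, so fuel m is always sufficient.
  closureFuel : ℕ → Subset m → Subset m × ℕ
  closureFuel zero    G = G , 0
  closureFuel (suc f) G =
    let J = bigJoin G
        k = findNext G (proj₁ J) (allFin m)
    in step (proj₁ k) (suc (proj₂ J + proj₂ k))
    where
    step : Maybe (Fin m) → ℕ → Subset m × ℕ
    step nothing  c = G , c
    step (just k) c = let r = closureFuel f (G ∪ ⁅ k ⁆) in proj₁ r , c + proj₂ r

  closure : Subset m → Subset m × ℕ
  closure = closureFuel m

  pairs : List (Fin m × Fin m)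
  pairs = concatMap (λ i → map (i ,_) (filter (λ j → toℕ i ℕ.<? toℕ j) (allFin m)))
                    (allFin m)

  data Output : Set where
    reducible   : Subset m → Output
    irreducible : Output

  runPairs : List (Fin m × Fin m) → Output × ℕ
  runPairs []             = irreducible , 0
  runPairs ((i , j) ∷ ps) =
    let r = closure (⁅ i ⁆ ∪ ⁅ j ⁆)
        G = proj₁ r
    in if allTrue G
       then (let o = runPairs ps in proj₁ o , suc (proj₂ r + m + proj₂ o))
       else (reducible G , suc (proj₂ r + m))

  run : Output × ℕ
  run = runPairs pairs

open Algorithm public using (Output; reducible; irreducible)

algorithm : ∀ {n m} (F : Vec (Subcube n) m) → Output F
algorithm F = proj₁ (Algorithm.run F)

algorithmCost : ∀ {n m} (F : Vec (Subcube n) m) → ℕ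
algorithmCost F = proj₂ (Algorithm.run F)

-- If the union of a subfamily G of the partition is a subcube t, then ⋁ G ⊆ t, and a member
-- meeting t shares a point with a member of G and therefore belongs to G. Hence the closure of
-- a pair {s_i, s_j} (add members meeting the join until none is left) lies inside every such
-- subfamily containing s_i and s_j. Conversely the union of a closed family G is exactly ⋁ G:
-- a point of ⋁ G lies in some member, which then meets ⋁ G and so belongs to G. So F is
-- reducible iff some pair closes up to a proper subfamily, which is what the algorithm tests.
-- Each closure takes at most m rounds of two scans of cost O(m n), and there are O(m²) pairs.
module Submission where

open import Defs
open import Data.Bool using (Bool; true; false; not)
open import Data.Bool.Properties using (not-¬)
open import Data.Maybe using (Maybe; just; nothing)
open import Data.Maybe.Relation.Unary.All as All using (All; just; nothing)
open import Data.Maybe.Relation.Unary.Any as Any using (Any; just)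
open import Data.Nat using (ℕ; zero; suc; NonZero; >-nonZero; _+_; _*_; _^_; _≤_; _<_; z≤n; s≤s; z<s)
open import Data.Nat.Properties hiding (_<?_)
open import Data.Nat.Tactic.RingSolver using (solve-∀)
open import Data.Fin using (Fin; toℕ; zero; suc)
open import Data.Fin.Properties using (_<?_)
open import Data.Fin.Subset using (Subset; _∈_; _∉_; _⊆_; Nonempty; ∣_∣; ⁅_⁆; _∪_; ⊤; inside; outside)
open import Data.Fin.Subset.Properties
open import Data.Vec using (Vec; []; _∷_; lookup; here; there)
import Data.Vec as Vec
open import Data.Vec.Properties using ([]=⇒lookup; lookup⇒[]=)
open import Data.Vec.Relation.Binary.Pointwise.Inductive as Pointwise using (Pointwise; []; _∷_)
open import Data.List using (List; []; _∷_; _++_; allFin; map; filter; concatMap; length)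
open import Data.List.Properties using (length-tabulate; length-map; length-++; length-filter)
open import Data.List.Membership.Propositional using () renaming (_∈_ to _∈ˡ_)
open import Data.List.Membership.Propositional.Properties
  using (∈-allFin; ∈-concatMap⁺; ∈-concatMap⁻; ∈-map⁺; ∈-map⁻; ∈-filter⁺; ∈-filter⁻)
open import Function using (id; _∘_)
open import Function.Bundles using (_⇔_; mk⇔)
import Data.List.Relation.Unary.Any as ListAny
open import Data.Product using (Σ; ∃; ∃₂; _×_; _,_; proj₁; proj₂)
open import Data.Sum using (inj₁; inj₂; [_,_])
open import Data.Unit using (tt)
open import Relation.Nullary using (¬_; yes; no; contradiction)
open import Relation.Binary.PropositionalEquality hiding ([_])

infix 4 _⊑_ _⊆ᶜ_
infixl 6 _∨ᶜ_

data _⊑_ : Cell → Cell → Set where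
  ⊑* : ∀ {c} → c ⊑ nothing
  ⊑-just : ∀ {b} → just b ⊑ just b

_⊆ᶜ_ : ∀ {n} → Subcube n → Subcube n → Set
_⊆ᶜ_ = Pointwise _⊑_

⊆ᶜ-refl : ∀ {n} {s : Subcube n} → s ⊆ᶜ s
⊆ᶜ-refl = Pointwise.refl ⊑-refl
  where
  ⊑-refl : ∀ {c} → c ⊑ c
  ⊑-refl {nothing} = ⊑*
  ⊑-refl {just b}  = ⊑-just

⊆ᶜ-trans : ∀ {n} {s t u : Subcube n} → s ⊆ᶜ t → t ⊆ᶜ u → s ⊆ᶜ u
⊆ᶜ-trans = Pointwise.trans ⊑-trans
  where
  ⊑-trans : ∀ {c d e} → c ⊑ d → d ⊑ e → c ⊑ e
  ⊑-trans _      ⊑*     = ⊑*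
  ⊑-trans ⊑-just ⊑-just = ⊑-just

∈ᶜ-⊆ᶜ : ∀ {n} {x : Point n} {s t} → x ∈ᶜ s → s ⊆ᶜ t → x ∈ᶜ t
∈ᶜ-⊆ᶜ = Pointwise.trans Match-⊑
  where
  Match-⊑ : ∀ {y c d} → Match y c → c ⊑ d → Match y d
  Match-⊑ _ ⊑*     = tt
  Match-⊑ p ⊑-just = p

_∨ᶜ_ : ∀ {n} → Subcube n → Subcube n → Subcube n
s ∨ᶜ t = proj₁ (joinC s t)

joinCell-upperˡ : ∀ c d → c ⊑ joinCell c d
joinCell-upperˡ nothing      d            = ⊑*
joinCell-upperˡ (just a)     nothing      = ⊑*
joinCell-upperˡ (just true)  (just true)  = ⊑-just
joinCell-upperˡ (just true)  (just false) = ⊑*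
joinCell-upperˡ (just false) (just true)  = ⊑*
joinCell-upperˡ (just false) (just false) = ⊑-just

joinCell-upperʳ : ∀ c d → d ⊑ joinCell c d
joinCell-upperʳ nothing      d            = ⊑*
joinCell-upperʳ (just a)     nothing      = ⊑*
joinCell-upperʳ (just true)  (just true)  = ⊑-just
joinCell-upperʳ (just true)  (just false) = ⊑*
joinCell-upperʳ (just false) (just true)  = ⊑*
joinCell-upperʳ (just false) (just false) = ⊑-just

joinCell-least : ∀ {c d e} → c ⊑ e → d ⊑ e → joinCell c d ⊑ e
joinCell-least ⊑*                  _      = ⊑*
joinCell-least (⊑-just {b = true})  ⊑-just = ⊑-just
joinCell-least (⊑-just {b = false}) ⊑-just = ⊑-just

∨ᶜ-upperˡ : ∀ {n} (s t : Subcube n) → s ⊆ᶜ s ∨ᶜ t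
∨ᶜ-upperˡ []      []      = []
∨ᶜ-upperˡ (c ∷ s) (d ∷ t) = joinCell-upperˡ c d ∷ ∨ᶜ-upperˡ s t

∨ᶜ-upperʳ : ∀ {n} (s t : Subcube n) → t ⊆ᶜ s ∨ᶜ t
∨ᶜ-upperʳ []      []      = []
∨ᶜ-upperʳ (c ∷ s) (d ∷ t) = joinCell-upperʳ c d ∷ ∨ᶜ-upperʳ s t

∨ᶜ-least : ∀ {n} {s t u : Subcube n} → s ⊆ᶜ u → t ⊆ᶜ u → s ∨ᶜ t ⊆ᶜ u
∨ᶜ-least []       []       = []
∨ᶜ-least (p ∷ ps) (q ∷ qs) = joinCell-least p q ∷ ∨ᶜ-least ps qs

-- Every word denotes a nonempty subcube, so the word order is exactly set inclusion.
someBool : Cell → Bool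
someBool nothing  = true
someBool (just b) = b

someBool-matches : ∀ c → Match (someBool c) c
someBool-matches nothing  = tt
someBool-matches (just b) = refl

somePoint : ∀ {n} → Subcube n → Point n
somePoint = Vec.map someBool

somePoint-∈ᶜ : ∀ {n} (s : Subcube n) → somePoint s ∈ᶜ s
somePoint-∈ᶜ []      = []
somePoint-∈ᶜ (c ∷ s) = someBool-matches c ∷ somePoint-∈ᶜ s

⊆⇒⊑ : ∀ c d → (∀ y → Match y c → Match y d) → c ⊑ d
⊆⇒⊑ c        nothing  _   = ⊑*
⊆⇒⊑ nothing  (just b) c⊆d = contradiction (sym (c⊆d (not b) tt)) (not-¬ refl)
⊆⇒⊑ (just a) (just b) c⊆d with c⊆d a refl
... | refl = ⊑-just

⊆⇒⊆ᶜ : ∀ {n} (s t : Subcube n) → (∀ x → x ∈ᶜ s → x ∈ᶜ t) → s ⊆ᶜ t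
⊆⇒⊆ᶜ []      []      _   = []
⊆⇒⊆ᶜ (c ∷ s) (d ∷ t) s⊆t =
  ⊆⇒⊑ c d (λ y y∈c → Pointwise.head (s⊆t (y ∷ somePoint s) (y∈c ∷ somePoint-∈ᶜ s)))
  ∷ ⊆⇒⊆ᶜ s t (λ x x∈s → Pointwise.tail (s⊆t (someBool c ∷ x) (someBool-matches c ∷ x∈s)))

Intersects : ∀ {n} → Subcube n → Subcube n → Set
Intersects s t = ∃ λ x → x ∈ᶜ s × x ∈ᶜ t

Intersects-⊆ᶜ : ∀ {n} {s t u : Subcube n} → Intersects s t → t ⊆ᶜ u → Intersects s u
Intersects-⊆ᶜ (x , x∈s , x∈t) t⊆u = x , x∈s , ∈ᶜ-⊆ᶜ x∈t t⊆u

eqB-sound : ∀ a b → eqB a b ≡ true → a ≡ b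
eqB-sound true  true  _ = refl
eqB-sound false false _ = refl

eqB-refl : ∀ a → eqB a a ≡ true
eqB-refl true  = refl
eqB-refl false = refl

meetCell-sound : ∀ c d → meetCell c d ≡ true → ∃ λ y → Match y c × Match y d
meetCell-sound nothing  nothing  _    = true , tt , tt
meetCell-sound nothing  (just b) _    = b , tt , refl
meetCell-sound (just a) nothing  _    = a , refl , tt
meetCell-sound (just a) (just b) a≡ᵇb = a , refl , eqB-sound a b a≡ᵇb

meetCell-complete : ∀ {y c d} → Match y c → Match y d → meetCell c d ≡ true
meetCell-complete {c = nothing}                 _    _    = refl
meetCell-complete {c = just a} {nothing}        _    _    = refl
meetCell-complete {y} {c = just a} {just b}     refl refl = eqB-refl y

intersectsC-sound : ∀ {n} (s t : Subcube n) → proj₁ (intersectsC s t) ≡ true → Intersects s t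
intersectsC-sound []      []      _ = [] , [] , []
intersectsC-sound (c ∷ s) (d ∷ t) p with meetCell c d in meet
... | true with meetCell-sound c d meet | intersectsC-sound s t p
...   | y , y∈c , y∈d | x , x∈s , x∈t = y ∷ x , y∈c ∷ x∈s , y∈d ∷ x∈t

intersectsC-complete : ∀ {n} {s t : Subcube n} → Intersects s t → proj₁ (intersectsC s t) ≡ true
intersectsC-complete (_ , [] , []) = refl
intersectsC-complete (y ∷ x , y∈c ∷ x∈s , y∈d ∷ x∈t)
  rewrite meetCell-complete y∈c y∈d = intersectsC-complete (x , x∈s , x∈t)

allTrue⇒≡⊤ : ∀ {m} (p : Subset m) → allTrue p ≡ true → p ≡ ⊤
allTrue⇒≡⊤ []           _   = refl
allTrue⇒≡⊤ (inside ∷ p) all = cong (inside ∷_) (allTrue⇒≡⊤ p all)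

allTrue-⊤ : ∀ m → allTrue (⊤ {m}) ≡ true
allTrue-⊤ zero    = refl
allTrue-⊤ (suc m) = allTrue-⊤ m

allTrue≡false⇒≢⊤ : ∀ {m} {p : Subset m} → allTrue p ≡ false → p ≢ ⊤
allTrue≡false⇒≢⊤ {m} notAll refl with () ← trans (sym notAll) (allTrue-⊤ m)

n≤∣p∣⇒p≡⊤ : ∀ {m} {p : Subset m} → m ≤ ∣ p ∣ → p ≡ ⊤
n≤∣p∣⇒p≡⊤ {p = p} m≤∣p∣ = ∣p∣≡n⇒p≡⊤ (≤-antisym (∣p∣≤n p) m≤∣p∣)

p≢⊤⇒∣p∣<n : ∀ {m} {p : Subset m} → p ≢ ⊤ → ∣ p ∣ < m
p≢⊤⇒∣p∣<n {p = p} p≢⊤ = ≤∧≢⇒< (∣p∣≤n p) (λ ∣p∣≡m → p≢⊤ (∣p∣≡n⇒p≡⊤ ∣p∣≡m))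

∣p∣<∣p∪⁅x⁆∣ : ∀ {m} {p : Subset m} {x} → x ∉ p → ∣ p ∣ < ∣ p ∪ ⁅ x ⁆ ∣
∣p∣<∣p∪⁅x⁆∣ {p = p} {x} x∉p =
  p⊂q⇒∣p∣<∣q∣ (p⊆p∪q ⁅ x ⁆ , x , x∈p∪q⁺ (inj₂ (x∈⁅x⁆ x)) , x∉p)

∪-⊆ : ∀ {m} {p q r : Subset m} → p ⊆ r → q ⊆ r → p ∪ q ⊆ r
∪-⊆ {p = p} {q} p⊆r q⊆r x∈p∪q = [ p⊆r , q⊆r ] (x∈p∪q⁻ p q x∈p∪q)

x∈p⇒⁅x⁆⊆p : ∀ {m} {p : Subset m} {x} → x ∈ p → ⁅ x ⁆ ⊆ p
x∈p⇒⁅x⁆⊆p {x = x} x∈p y∈⁅x⁆ = subst (_∈ _) (sym (x∈⁅y⁆⇒x≡y x y∈⁅x⁆)) x∈p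

x∈p∧y∈p∧x≢y⇒1<∣p∣ : ∀ {m} {p : Subset m} {x y} → x ∈ p → y ∈ p → x ≢ y → 1 < ∣ p ∣
x∈p∧y∈p∧x≢y⇒1<∣p∣ {x = x} x∈p y∈p x≢y = subst (_< _) (∣⁅x⁆∣≡1 x)
  (p⊂q⇒∣p∣<∣q∣ (x∈p⇒⁅x⁆⊆p x∈p ,
                _ , y∈p , λ y∈⁅x⁆ → x≢y (sym (x∈⁅y⁆⇒x≡y x y∈⁅x⁆))))

0<∣p∣⇒Nonempty : ∀ {m} {p : Subset m} → 0 < ∣ p ∣ → Nonempty p
0<∣p∣⇒Nonempty {m} {p} 0<∣p∣ with nonempty? p
... | yes ne = ne
... | no  ¬ne = contradiction (trans (cong ∣_∣ (Empty-unique ¬ne)) (∣⊥∣≡0 m)) (>⇒≢ 0<∣p∣)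

1<∣p∣⇒twoMembers : ∀ {m} (p : Subset m) → 1 < ∣ p ∣ → ∃₂ λ i j → toℕ i < toℕ j × i ∈ p × j ∈ p
1<∣p∣⇒twoMembers (inside ∷ p) (s≤s 0<∣p∣) with 0<∣p∣⇒Nonempty 0<∣p∣
... | j , j∈p = zero , suc j , z<s , here , there j∈p
1<∣p∣⇒twoMembers (outside ∷ p) 1<∣p∣ with 1<∣p∣⇒twoMembers p 1<∣p∣
... | i , j , i<j , i∈p , j∈p = suc i , suc j , s≤s i<j , there i∈p , there j∈p

lookup≡false⇒∉ : ∀ {m} (p : Subset m) {x} → lookup p x ≡ false → x ∉ p
lookup≡false⇒∉ p px≡false x∈p with () ← trans (sym ([]=⇒lookup x∈p)) px≡false

pairsFrom : ∀ {m} → Fin m → List (Fin m × Fin m)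
pairsFrom {m} i = map (i ,_) (filter (i <?_) (allFin m))

length-concatMap≤ : ∀ {A B : Set} (f : A → List B) xs {b} →
                    (∀ x → length (f x) ≤ b) → length (concatMap f xs) ≤ length xs * b
length-concatMap≤ f []       _     = z≤n
length-concatMap≤ f (x ∷ xs) bound = begin
  length (f x ++ concatMap f xs)                ≡⟨ length-++ (f x) ⟩
  length (f x) + length (concatMap f xs)        ≤⟨ +-mono-≤ (bound x) (length-concatMap≤ f xs bound) ⟩
  _ + length xs * _                             ∎
  where open ≤-Reasoning

module Correctness {n m : ℕ} (F : Vec (Subcube n) m) where
  open Algorithm F hiding (Output; reducible; irreducible)

  UpperBound : Subset m → Subcube n → Set
  UpperBound G u = ∀ {k} → k ∈ G → lookup F k ⊆ᶜ u

  joinMaybe-keeps : ∀ (acc : Maybe (Subcube n)) t {s} →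
                    Any (s ⊆ᶜ_) acc → Any (s ⊆ᶜ_) (proj₁ (joinMaybe acc t))
  joinMaybe-keeps (just a) t (just s⊆a) = just (⊆ᶜ-trans s⊆a (∨ᶜ-upperˡ a t))

  joinMaybe-new : ∀ (acc : Maybe (Subcube n)) t → Any (t ⊆ᶜ_) (proj₁ (joinMaybe acc t))
  joinMaybe-new nothing  t = just ⊆ᶜ-refl
  joinMaybe-new (just a) t = just (∨ᶜ-upperʳ a t)

  joinMaybe-least : ∀ {acc t} {u : Subcube n} →
                    All (_⊆ᶜ u) acc → t ⊆ᶜ u → All (_⊆ᶜ u) (proj₁ (joinMaybe acc t))
  joinMaybe-least nothing      t⊆u = just t⊆u
  joinMaybe-least (just acc⊆u) t⊆u = just (∨ᶜ-least acc⊆u t⊆u)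

  bigJoinOver-keeps : ∀ G acc ks {s : Subcube n} →
                      Any (s ⊆ᶜ_) acc → Any (s ⊆ᶜ_) (proj₁ (bigJoinOver G acc ks))
  bigJoinOver-keeps G acc []       s⊆acc = s⊆acc
  bigJoinOver-keeps G acc (k ∷ ks) s⊆acc with lookup G k
  ... | false = bigJoinOver-keeps G acc ks s⊆acc
  ... | true  = bigJoinOver-keeps G _ ks (joinMaybe-keeps acc (lookup F k) s⊆acc)

  bigJoinOver-upper : ∀ G acc {ks k} → k ∈ˡ ks → k ∈ G →
                      Any (lookup F k ⊆ᶜ_) (proj₁ (bigJoinOver G acc ks))
  bigJoinOver-upper G acc {k ∷ ks} (ListAny.here refl) k∈G rewrite []=⇒lookup k∈G =
    bigJoinOver-keeps G _ ks (joinMaybe-new acc (lookup F k))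
  bigJoinOver-upper G acc {k′ ∷ ks} (ListAny.there k∈ks) k∈G with lookup G k′
  ... | false = bigJoinOver-upper G acc k∈ks k∈G
  ... | true  = bigJoinOver-upper G _ k∈ks k∈G

  bigJoinOver-least : ∀ G acc ks {u : Subcube n} → All (_⊆ᶜ u) acc →
                      (∀ {k} → k ∈ˡ ks → k ∈ G → lookup F k ⊆ᶜ u) →
                      All (_⊆ᶜ u) (proj₁ (bigJoinOver G acc ks))
  bigJoinOver-least G acc []       acc⊆u _     = acc⊆u
  bigJoinOver-least G acc (k ∷ ks) acc⊆u bound with lookup G k in k∈?G
  ... | false = bigJoinOver-least G acc ks acc⊆u (bound ∘ ListAny.there)
  ... | true  = bigJoinOver-least G _ ks
                  (joinMaybe-least acc⊆u (bound (ListAny.here refl) (lookup⇒[]= k G k∈?G)))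
                  (bound ∘ ListAny.there)

  bigJoin-just : ∀ {G i} → i ∈ G → ∃ λ J → proj₁ (bigJoin G) ≡ just J
  bigJoin-just {G} i∈G with proj₁ (bigJoin G) | bigJoinOver-upper G nothing (∈-allFin _) i∈G
  ... | just J | _ = J , refl

  bigJoin-upper : ∀ {G J} → proj₁ (bigJoin G) ≡ just J → UpperBound G J
  bigJoin-upper {G} ⋁G≡J k∈G =
    Any.drop-just (subst (Any _) ⋁G≡J (bigJoinOver-upper G nothing (∈-allFin _) k∈G))

  bigJoin-least : ∀ {G J u} → proj₁ (bigJoin G) ≡ just J → UpperBound G u → J ⊆ᶜ u
  bigJoin-least {G} ⋁G≡J bound =
    All.drop-just (subst (All _) ⋁G≡J (bigJoinOver-least G nothing (allFin m) nothing (λ _ → bound)))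

  findNext-sound : ∀ G J ks {k} → proj₁ (findNext G J ks) ≡ just k →
                   k ∉ G × ∃ λ J′ → J ≡ just J′ × Intersects (lookup F k) J′
  findNext-sound G (just J) (k′ ∷ ks) found with lookup G k′ in k′∈?G
  ... | true = findNext-sound G (just J) ks found
  ... | false with intersectsC (lookup F k′) J in meets
  ...   | false , _ = findNext-sound G (just J) ks found
  findNext-sound G (just J) (k′ ∷ ks) refl | false | true , _ =
    lookup≡false⇒∉ G k′∈?G , J , refl , intersectsC-sound (lookup F k′) J (cong proj₁ meets)

  findNext-complete : ∀ G J ks {k} → proj₁ (findNext G (just J) ks) ≡ nothing → k ∈ˡ ks → k ∉ G →
                      ¬ Intersects (lookup F k) J
  findNext-complete G J (k′ ∷ ks) none k∈ks k∉G with lookup G k′ in k′∈?G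
  findNext-complete G J (k′ ∷ ks) none (ListAny.here refl) k∉G | true =
    contradiction (lookup⇒[]= k′ G k′∈?G) k∉G
  findNext-complete G J (k′ ∷ ks) none (ListAny.there k∈ks) k∉G | true =
    findNext-complete G J ks none k∈ks k∉G
  ... | false with intersectsC (lookup F k′) J in meets
  findNext-complete G J (k′ ∷ ks) none (ListAny.here refl) k∉G | false | false , _ =
    λ k′∩J → contradiction (trans (sym (intersectsC-complete k′∩J)) (cong proj₁ meets)) λ ()
  findNext-complete G J (k′ ∷ ks) none (ListAny.there k∈ks) k∉G | false | false , _ =
    findNext-complete G J ks none k∈ks k∉G

  Closed : Subset m → Set
  Closed G = ∀ {J k} → proj₁ (bigJoin G) ≡ just J → k ∉ G → ¬ Intersects (lookup F k) J

  closureFuel-⊇ : ∀ f G → G ⊆ proj₁ (closureFuel f G)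
  closureFuel-⊇ zero    G k∈G = k∈G
  closureFuel-⊇ (suc f) G k∈G with proj₁ (findNext G (proj₁ (bigJoin G)) (allFin m))
  ... | nothing = k∈G
  ... | just k′ = closureFuel-⊇ f (G ∪ ⁅ k′ ⁆) (p⊆p∪q ⁅ k′ ⁆ k∈G)

  -- Every round adds a new member, so f rounds suffice once m ≤ f + ∣ G ∣.
  closureFuel-closed : ∀ f G → m ≤ f + ∣ G ∣ → Closed (proj₁ (closureFuel f G))
  closureFuel-closed zero    G m≤∣G∣ _ k∉G = contradiction (subst (_ ∈_) (sym (n≤∣p∣⇒p≡⊤ m≤∣G∣)) ∈⊤) k∉G
  closureFuel-closed (suc f) G m≤f+∣G∣ with proj₁ (findNext G (proj₁ (bigJoin G)) (allFin m)) in found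
  ... | nothing = λ ⋁G≡J → findNext-complete G _ (allFin m)
                             (subst (λ ⋁G → proj₁ (findNext G ⋁G (allFin m)) ≡ nothing) ⋁G≡J found)
                             (∈-allFin _)
  ... | just k = closureFuel-closed f (G ∪ ⁅ k ⁆) (begin
          m                    ≤⟨ m≤f+∣G∣ ⟩
          suc f + ∣ G ∣        ≡⟨ +-suc f ∣ G ∣ ⟨
          f + suc ∣ G ∣        ≤⟨ +-monoʳ-≤ f (∣p∣<∣p∪⁅x⁆∣ (proj₁ (findNext-sound G _ (allFin m) found))) ⟩
          f + ∣ G ∪ ⁅ k ⁆ ∣    ∎)
    where open ≤-Reasoning

  Absorbing : Subset m → Set
  Absorbing G′ = ∃ λ t → UpperBound G′ t × (∀ {k} → Intersects (lookup F k) t → k ∈ G′)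

  closureFuel-⊆ : ∀ {G′} → Absorbing G′ → ∀ f {G} → G ⊆ G′ → proj₁ (closureFuel f G) ⊆ G′
  closureFuel-⊆ _ zero G⊆G′ = G⊆G′
  closureFuel-⊆ absorbing@(t , G′⊆t , meets⇒∈) (suc f) {G} G⊆G′
    with proj₁ (findNext G (proj₁ (bigJoin G)) (allFin m)) in found
  ... | nothing = G⊆G′
  ... | just k with findNext-sound G _ (allFin m) found
  ...   | _ , J , ⋁G≡J , k∩J = closureFuel-⊆ absorbing f (∪-⊆ G⊆G′ (x∈p⇒⁅x⁆⊆p k∈G′))
    where
    k∈G′ : k ∈ _
    k∈G′ = meets⇒∈ (Intersects-⊆ᶜ k∩J (bigJoin-least ⋁G≡J (G′⊆t ∘ G⊆G′)))

  pairClosure : Fin m → Fin m → Subset m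
  pairClosure i j = proj₁ (closure (⁅ i ⁆ ∪ ⁅ j ⁆))

  runPairs-sound : ∀ ps {G} → proj₁ (runPairs ps) ≡ reducible G →
                   ∃₂ λ i j → (i , j) ∈ˡ ps × G ≡ pairClosure i j × G ≢ ⊤
  runPairs-sound ((i , j) ∷ ps) found with allTrue (pairClosure i j) in full?
  ... | true with runPairs-sound ps found
  ...   | i′ , j′ , ij′∈ps , G≡ , proper = i′ , j′ , ListAny.there ij′∈ps , G≡ , proper
  runPairs-sound ((i , j) ∷ ps) refl | false =
    i , j , ListAny.here refl , refl , allTrue≡false⇒≢⊤ full?

  runPairs-complete : ∀ ps {i j} → (i , j) ∈ˡ ps → pairClosure i j ≢ ⊤ →
                      ∃ λ G → proj₁ (runPairs ps) ≡ reducible G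
  runPairs-complete ((i′ , j′) ∷ ps) ij∈ps proper with allTrue (pairClosure i′ j′) in full?
  ... | false = _ , refl
  runPairs-complete ((i′ , j′) ∷ ps) (ListAny.here refl)  proper | true =
    contradiction (allTrue⇒≡⊤ _ full?) proper
  runPairs-complete ((i′ , j′) ∷ ps) (ListAny.there ij∈ps) proper | true =
    runPairs-complete ps ij∈ps proper

  ∈-pairs⁻ : ∀ {i j} → (i , j) ∈ˡ pairs → toℕ i < toℕ j
  ∈-pairs⁻ ij∈pairs with ListAny.satisfied (∈-concatMap⁻ pairsFrom {xs = allFin m} ij∈pairs)
  ... | i , ij∈row with ∈-map⁻ (i ,_) ij∈row
  ...   | j , j∈later , refl = proj₂ (∈-filter⁻ (i <?_) {xs = allFin m} j∈later)

  ∈-pairs⁺ : ∀ {i j} → toℕ i < toℕ j → (i , j) ∈ˡ pairs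
  ∈-pairs⁺ {i} {j} i<j = ∈-concatMap⁺ pairsFrom {xs = allFin m}
    (ListAny.map (λ { refl → ∈-map⁺ (i ,_) (∈-filter⁺ (i <?_) (∈-allFin j) i<j) })
                 (∈-allFin i))

  module _ (partition : IsPartition F) where

    closed⇒UnionIsSubcube : ∀ {G i} → i ∈ G → Closed G → UnionIsSubcube F G
    closed⇒UnionIsSubcube {G} i∈G closed with bigJoin-just i∈G
    ... | J , ⋁G≡J = J , λ x → J⊆⋃G x , λ (k , k∈G , x∈k) → ∈ᶜ-⊆ᶜ x∈k (bigJoin-upper ⋁G≡J k∈G)
      where
      J⊆⋃G : ∀ x → x ∈ᶜ J → ∃ λ k → k ∈ G × x ∈ᶜ lookup F k
      J⊆⋃G x x∈J with proj₁ partition x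
      ... | k , x∈k with k ∈? G
      ...   | yes k∈G = k , k∈G , x∈k
      ...   | no  k∉G = contradiction (x , x∈k , x∈J) (closed ⋁G≡J k∉G)

    UnionIsSubcube⇒Absorbing : ∀ {G} → UnionIsSubcube F G → Absorbing G
    UnionIsSubcube⇒Absorbing {G} (t , ⋃G≡t) = t , G⊆t , meets⇒∈
      where
      G⊆t : UpperBound G t
      G⊆t {k} k∈G = ⊆⇒⊆ᶜ (lookup F k) t (λ x x∈k → proj₂ (⋃G≡t x) (k , k∈G , x∈k))
      meets⇒∈ : ∀ {k} → Intersects (lookup F k) t → k ∈ G
      meets⇒∈ (x , x∈k , x∈t) with proj₁ (⋃G≡t x) x∈t
      ... | i , i∈G , x∈i = subst (_∈ G) (proj₂ partition x i _ x∈i x∈k) i∈G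

    pairClosure-reducing : ∀ {i j} → i ≢ j → pairClosure i j ≢ ⊤ → ReducingSet F (pairClosure i j)
    pairClosure-reducing {i} {j} i≢j proper =
      x∈p∧y∈p∧x≢y⇒1<∣p∣ i∈ j∈ i≢j ,
      p≢⊤⇒∣p∣<n proper ,
      closed⇒UnionIsSubcube i∈ (closureFuel-closed m _ (m≤m+n m _))
      where
      i∈ = closureFuel-⊇ m _ (x∈p∪q⁺ (inj₁ (x∈⁅x⁆ i)))
      j∈ = closureFuel-⊇ m _ (x∈p∪q⁺ (inj₂ (x∈⁅x⁆ j)))

    pairClosure-proper : ∀ {G i j} → UnionIsSubcube F G → ∣ G ∣ < m → i ∈ G → j ∈ G →
                         pairClosure i j ≢ ⊤
    pairClosure-proper {G} ⋃G-subcube ∣G∣<m i∈G j∈G closure≡⊤ = <⇒≱ ∣G∣<m (begin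
      m                    ≡⟨ ∣⊤∣≡n m ⟨
      ∣ ⊤ {m} ∣            ≤⟨ p⊆q⇒∣p∣≤∣q∣ (subst (_⊆ G) closure≡⊤ closure⊆G) ⟩
      ∣ G ∣                ∎)
      where
      open ≤-Reasoning
      closure⊆G = closureFuel-⊆ (UnionIsSubcube⇒Absorbing ⋃G-subcube) m
                    (∪-⊆ (x∈p⇒⁅x⁆⊆p i∈G) (x∈p⇒⁅x⁆⊆p j∈G))

    algorithm-sound : ∀ {G} → proj₁ run ≡ reducible G → ReducingSet F G
    algorithm-sound found with runPairs-sound pairs found
    ... | i , j , ij∈pairs , refl , proper =
      pairClosure-reducing (<⇒≢ (∈-pairs⁻ ij∈pairs) ∘ cong toℕ) proper

    algorithm-complete : Reducible F → ∃ λ G → proj₁ run ≡ reducible G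
    algorithm-complete (G , 1<∣G∣ , ∣G∣<m , ⋃G-subcube) with 1<∣p∣⇒twoMembers G 1<∣G∣
    ... | i , j , i<j , i∈G , j∈G =
      runPairs-complete pairs (∈-pairs⁺ i<j) (pairClosure-proper ⋃G-subcube ∣G∣<m i∈G j∈G)

    algorithm-irreducible : proj₁ run ≡ irreducible ⇔ Irreducible F
    algorithm-irreducible = mk⇔ to from
      where
      to : proj₁ run ≡ irreducible → Irreducible F
      to ran F-reducible with () ← trans (sym ran) (proj₂ (algorithm-complete F-reducible))
      from : Irreducible F → proj₁ run ≡ irreducible
      from irr with proj₁ run in ran
      ... | irreducible = refl
      ... | reducible G = contradiction (G , algorithm-sound ran) irr

-- m² pairs, each closed in at most m rounds of two scans of cost m N, then tested in m steps
costPoly : ℕ → ℕ → ℕ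
costPoly m N = m * m * suc (m * suc (m * N + m * N) + m)

costPoly-mono : ∀ {m N} → m ≤ N → costPoly m N ≤ costPoly N N
costPoly-mono {m} {N} m≤N =
  *-mono-≤ (*-mono-≤ m≤N m≤N)
    (s≤s (+-mono-≤ (*-mono-≤ m≤N (s≤s (+-mono-≤ (*-monoˡ-≤ N m≤N) (*-monoˡ-≤ N m≤N)))) m≤N))

costPoly-diag : ∀ N → .{{NonZero N}} → costPoly N N ≤ 5 * N ^ 5
costPoly-diag N = begin
  costPoly N N                      ≡⟨ expansion N ⟩
  2 * N ^ 5 + 2 * N ^ 3 + N ^ 2     ≤⟨ +-mono-≤ (+-monoʳ-≤ (2 * N ^ 5) (*-monoʳ-≤ 2 (^-monoʳ-≤ N (m≤m+n 3 2))))
                                                (^-monoʳ-≤ N (m≤m+n 2 3)) ⟩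
  2 * N ^ 5 + 2 * N ^ 5 + N ^ 5     ≡⟨ cong (_+ N ^ 5) (sym (*-distribʳ-+ (N ^ 5) 2 2)) ⟩
  4 * N ^ 5 + N ^ 5                 ≡⟨ +-comm (4 * N ^ 5) (N ^ 5) ⟩
  5 * N ^ 5                         ∎
  where
  open ≤-Reasoning
  -- the ring solver reads neither _^_ nor costPoly, so both are spelled out
  expansion : ∀ N → N * N * suc (N * suc (N * N + N * N) + N) ≡
                    2 * (N * (N * (N * (N * (N * 1))))) + 2 * (N * (N * (N * 1))) + N * (N * 1)
  expansion = solve-∀

module Cost {n m : ℕ} (F : Vec (Subcube n) m) where
  open Algorithm F hiding (Output; reducible; irreducible)

  N : ℕ
  N = n + m + 1

  joinMaybe-cost : ∀ acc t → proj₂ (joinMaybe acc t) ≤ suc n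
  joinMaybe-cost nothing  t = s≤s z≤n
  joinMaybe-cost (just s) t = n≤1+n n

  bigJoinOver-cost : ∀ G acc ks → proj₂ (bigJoinOver G acc ks) ≤ length ks * (2 + n)
  bigJoinOver-cost G acc []       = z≤n
  bigJoinOver-cost G acc (k ∷ ks) with lookup G k
  ... | false = s≤s (≤-trans (bigJoinOver-cost G acc ks) (m≤n+m _ (suc n)))
  ... | true  = s≤s (+-mono-≤ (joinMaybe-cost acc (lookup F k)) (bigJoinOver-cost G _ ks))

  findNext-cost : ∀ G J ks → proj₂ (findNext G J ks) ≤ length ks * (2 + n)
  findNext-cost G J        []       = z≤n
  findNext-cost G nothing  (k ∷ ks) = s≤s z≤n
  findNext-cost G (just J) (k ∷ ks) with lookup G k
  ... | true = s≤s (≤-trans (findNext-cost G (just J) ks) (m≤n+m _ (suc n)))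
  ... | false with intersectsC (lookup F k) J in meets
  ...   | true  , c = s≤s (≤-trans (≤-reflexive (cong proj₂ (sym meets))) (≤-trans (n≤1+n n) (m≤m+n _ _)))
  ...   | false , c = s≤s (+-mono-≤ (≤-trans (≤-reflexive (cong proj₂ (sym meets))) (n≤1+n n))
                                    (findNext-cost G (just J) ks))

  pass-cost : ∀ {c} → c ≤ length (allFin m) * (2 + n) → c ≤ m * N
  pass-cost c≤ = ≤-trans c≤
    (subst (λ l → l * (2 + n) ≤ m * N) (sym (length-tabulate {n = m} id)) (per-index m))
    where
    per-index : ∀ m′ → m′ * (2 + n) ≤ m′ * (n + m′ + 1)
    per-index zero     = z≤n
    per-index (suc m′) = *-monoʳ-≤ (suc m′) (begin
      2 + n              ≤⟨ s≤s (s≤s (m≤m+n n m′)) ⟩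
      2 + (n + m′)       ≡⟨ reorder n m′ ⟩
      n + suc m′ + 1     ∎)
      where
      open ≤-Reasoning
      reorder : ∀ n m′ → 2 + (n + m′) ≡ n + suc m′ + 1
      reorder = solve-∀

  round-cost : ∀ G → suc (proj₂ (bigJoin G) + proj₂ (findNext G (proj₁ (bigJoin G)) (allFin m))) ≤
                     suc (m * N + m * N)
  round-cost G = s≤s (+-mono-≤ (pass-cost (bigJoinOver-cost G nothing (allFin m)))
                               (pass-cost (findNext-cost G _ (allFin m))))

  closureFuel-cost : ∀ f G → proj₂ (closureFuel f G) ≤ f * suc (m * N + m * N)
  closureFuel-cost zero    G = z≤n
  closureFuel-cost (suc f) G with proj₁ (findNext G (proj₁ (bigJoin G)) (allFin m))
  ... | nothing = ≤-trans (round-cost G) (m≤m+n _ _)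
  ... | just k  = +-mono-≤ (round-cost G) (closureFuel-cost f (G ∪ ⁅ k ⁆))

  runPairs-cost : ∀ ps → proj₂ (runPairs ps) ≤ length ps * suc (m * suc (m * N + m * N) + m)
  runPairs-cost []             = z≤n
  runPairs-cost ((i , j) ∷ ps) with allTrue (proj₁ (closure (⁅ i ⁆ ∪ ⁅ j ⁆)))
  ... | true  = s≤s (+-mono-≤ (+-monoˡ-≤ m (closureFuel-cost m _)) (runPairs-cost ps))
  ... | false = s≤s (≤-trans (+-monoˡ-≤ m (closureFuel-cost m _)) (m≤m+n _ _))

  length-pairs : length pairs ≤ m * m
  length-pairs = subst (λ l → length pairs ≤ l * m) (length-tabulate {n = m} id)
    (length-concatMap≤ pairsFrom (allFin m) λ i → begin
      length (pairsFrom i)                ≡⟨ length-map (i ,_) (filter (i <?_) (allFin m)) ⟩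
      length (filter (i <?_) (allFin m))  ≤⟨ length-filter (i <?_) (allFin m) ⟩
      length (allFin m)                   ≡⟨ length-tabulate id ⟩
      m                                   ∎)
    where open ≤-Reasoning

  run-cost : proj₂ run ≤ 5 * N ^ 5
  run-cost = begin
    proj₂ run        ≤⟨ runPairs-cost pairs ⟩
    length pairs * _ ≤⟨ *-monoˡ-≤ _ length-pairs ⟩
    costPoly m N     ≤⟨ costPoly-mono (≤-trans (m≤n+m m n) (m≤m+n _ 1)) ⟩
    costPoly N N     ≤⟨ costPoly-diag N {{>-nonZero (m≤n+m 1 (n + m))}} ⟩
    5 * N ^ 5        ∎
    where open ≤-Reasoning

theorem2p7 :
    (Σ ℕ λ c → Σ ℕ λ d → ∀ (n m : ℕ) (F : Vec (Subcube n) m) → IsPartition F →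
        algorithmCost F ≤ c * (n + m + 1) ^ d)
    × (∀ (n m : ℕ) (F : Vec (Subcube n) m) → IsPartition F →
        (∀ G → algorithm F ≡ reducible G → ReducingSet F G)
        × (Reducible F → Σ _ λ G → algorithm F ≡ reducible G)
        × (algorithm F ≡ irreducible ⇔ Irreducible F))
theorem2p7 =
  (5 , 5 , λ _ _ F _ → Cost.run-cost F) ,
  λ _ _ F partition → let open Correctness F in
    (λ _ → algorithm-sound partition) ,
    algorithm-complete partition ,
    algorithm-irreducible partition
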